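{- Every cycle $C_n$ ($n\ge 3$) admits a good $2$-tone $6$-coloring.
   Context: A $2$-tone $k$-coloring of a graph $G$ assigns to each vertex $v$ a $2$-element subset $f(v)\subseteq\{1,\dots,k\}$ such that $|f(u)\cap f(v)|<d_G(u,v)$ for all distinct vertices $u,v$ ($d_G$ the graph distance). A good $2$-tone $k$-coloring is a $2$-tone $k$-coloring in which any two vertices at distance exactly two share exactly one common color. -}

module Defs where

open import Data.Nat using (ℕ; zero; suc; _<_)
open import Data.Fin using (Fin; toℕ)
open import Data.Fin.Subset using (Subset; _∩_; ∣_∣)
open import Data.Sum using (_⊎_)
open import Data.Product using (_×_)
open import Relation.Nullary using (¬_)
open import Relation.Binary.PropositionalEquality using (_≡_; _≢_)

Graph : ℕ → Set₁
Graph n = Fin n → Fin n → Set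

-- The cycle C_n on vertices 0,1,…,n-1: i ~ j iff j = i+1 (mod n) or i = j+1 (mod n).
CycleSucc : (n : ℕ) → Fin n → Fin n → Set
CycleSucc n i j = (toℕ j ≡ suc (toℕ i)) ⊎ ((toℕ j ≡ 0) × (suc (toℕ i) ≡ n))

Cycle : (n : ℕ) → Graph n
Cycle n i j = CycleSucc n i j ⊎ CycleSucc n j i

data Walk {n : ℕ} (G : Graph n) : ℕ → Fin n → Fin n → Set where
  here : ∀ {u} → Walk G 0 u u
  step : ∀ {k u w v} → G u w → Walk G k w v → Walk G (suc k) u v

-- d_G(u,v) is the least k with a walk of length k from u to v (∞ if none).
-- "m < d_G(u,v)" means: m < k for every walk length k from u to v.
_<dist[_]_,_ : ℕ → {n : ℕ} → Graph n → Fin n → Fin n → Set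
m <dist[ G ] u , v = ∀ k → Walk G k u v → m < k

-- "d_G(u,v) = 2": a walk of length 2 exists, and none of length 0 or 1.
Dist2 : {n : ℕ} → Graph n → Fin n → Fin n → Set
Dist2 G u v = Walk G 2 u v × u ≢ v × ¬ G u v

-- A 2-tone k-coloring: f v is a 2-element subset of {1..k} (here Fin k),
-- and |f u ∩ f v| < d_G(u,v) for all distinct u, v.
Is2ToneColoring : {n : ℕ} → Graph n → (k : ℕ) → (Fin n → Subset k) → Set
Is2ToneColoring {n} G k f =
  (∀ v → ∣ f v ∣ ≡ 2) ×
  (∀ u v → u ≢ v → ∣ f u ∩ f v ∣ <dist[ G ] u , v)

IsGood2ToneColoring : {n : ℕ} → Graph n → (k : ℕ) → (Fin n → Subset k) → Set
IsGood2ToneColoring G k f =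
  Is2ToneColoring G k f × (∀ u v → Dist2 G u v → ∣ f u ∩ f v ∣ ≡ 1)

{-# OPTIONS --safe #-}
module Submission where

-- Since colour sets have two elements, only vertices at distance one or two
-- constrain a 2-tone colouring. On C_n with n ≥ 4 a good colouring is thus a
-- cyclic sequence of pairs in which neighbours are disjoint and pairs two
-- steps apart share one colour. With six colours the block 01 23 04 25 can be
-- repeated, and every n ≥ 4 is reached by ending with one of four closing
-- blocks of lengths 4 to 7. C_3 is complete, so three disjoint pairs do.

open import Defs
open import Data.Nat using (ℕ; zero; suc; _+_; _≤_; _<_; _≟_; z<s; s≤s)
open import Data.Nat.Properties using (1+n≢0; <-irrefl; suc-injective; ≤-reflexive; ≤-trans; m≤m+n)
open import Data.Fin using (Fin; toℕ)
open import Data.Fin.Patterns using (0F; 1F; 2F; 3F; 4F; 5F)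
open import Data.Fin.Properties using (toℕ-injective; toℕ<n)
open import Data.Fin.Subset using (Subset; _∩_; _∪_; ⁅_⁆; ∣_∣; ⊥)
open import Data.Fin.Subset.Properties using (∩-comm; ∣p∩q∣≤∣p∣)
open import Data.List using (List; []; _∷_; length)
open import Data.Product using (Σ; _×_; _,_; proj₁; proj₂)
open import Data.Sum using (_⊎_; inj₁; inj₂)
open import Data.Unit using (⊤; tt)
open import Relation.Nullary using (Dec; yes; contradiction)
open import Relation.Nullary.Decidable using (_×-dec_; from-yes)
open import Relation.Binary.PropositionalEquality
  using (_≡_; _≢_; refl; sym; trans; cong; subst; module ≡-Reasoning)

isGood2ToneColoring : ∀ {n k} {G : Graph n} {f : Fin n → Subset k} →
  (∀ v → ∣ f v ∣ ≡ 2) →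
  (∀ {u v} → G u v → ∣ f u ∩ f v ∣ ≡ 0) →
  (∀ {u w v} → u ≢ v → G u w → G w v → ∣ f u ∩ f v ∣ ≡ 1) →
  IsGood2ToneColoring G k f
isGood2ToneColoring {G = G} {f} sizes adjacent two-apart =
  (sizes , below-distance) ,
  λ { u v (step e₁ (step e₂ here) , u≢v , _) → two-apart u≢v e₁ e₂ }
  where
  below-distance : ∀ u v → u ≢ v → ∣ f u ∩ f v ∣ <dist[ G ] u , v
  below-distance u v u≢v 0 here = contradiction refl u≢v
  below-distance u v u≢v 1 (step e here) = ≤-reflexive (cong suc (adjacent e))
  below-distance u v u≢v 2 (step e₁ (step e₂ here)) = ≤-reflexive (cong suc (two-apart u≢v e₁ e₂))
  below-distance u v u≢v (suc (suc (suc k))) _ =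
    s≤s (≤-trans (subst (∣ f u ∩ f v ∣ ≤_) (sizes u) (∣p∩q∣≤∣p∣ (f u) (f v))) (m≤m+n 2 k))

complete⇒isGood2ToneColoring : ∀ {n k} {G : Graph n} {f : Fin n → Subset k} →
  (∀ {u v} → u ≢ v → G u v) →
  (∀ v → ∣ f v ∣ ≡ 2) →
  (∀ {u v} → u ≢ v → ∣ f u ∩ f v ∣ ≡ 0) →
  IsGood2ToneColoring G k f
complete⇒isGood2ToneColoring {G = G} {f} complete sizes disjoint =
  (sizes , below-distance) ,
  λ { u v (_ , u≢v , ¬adjacent) → contradiction (complete u≢v) ¬adjacent }
  where
  below-distance : ∀ u v → u ≢ v → ∣ f u ∩ f v ∣ <dist[ G ] u , v
  below-distance u v u≢v 0 here = contradiction refl u≢v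
  below-distance u v u≢v (suc k) _ = subst (_< suc k) (sym (disjoint u≢v)) z<s

module _ {n : ℕ} where

  CycleSucc-injective : ∀ {u v w} → CycleSucc n u w → CycleSucc n v w → u ≡ v
  CycleSucc-injective (inj₁ w≡1+u) (inj₁ w≡1+v) = toℕ-injective (suc-injective (trans (sym w≡1+u) w≡1+v))
  CycleSucc-injective (inj₁ w≡1+u) (inj₂ (w≡0 , _)) = contradiction (trans (sym w≡1+u) w≡0) 1+n≢0
  CycleSucc-injective (inj₂ (w≡0 , _)) (inj₁ w≡1+v) = contradiction (trans (sym w≡1+v) w≡0) 1+n≢0
  CycleSucc-injective (inj₂ (_ , 1+u≡n)) (inj₂ (_ , 1+v≡n)) = toℕ-injective (suc-injective (trans 1+u≡n (sym 1+v≡n)))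

  CycleSucc-functional : ∀ {u v w} → CycleSucc n w u → CycleSucc n w v → u ≡ v
  CycleSucc-functional (inj₁ u≡1+w) (inj₁ v≡1+w) = toℕ-injective (trans u≡1+w (sym v≡1+w))
  CycleSucc-functional {u} (inj₁ u≡1+w) (inj₂ (_ , 1+w≡n)) = contradiction (toℕ<n u) (<-irrefl (trans u≡1+w 1+w≡n))
  CycleSucc-functional {v = v} (inj₂ (_ , 1+w≡n)) (inj₁ v≡1+w) = contradiction (toℕ<n v) (<-irrefl (trans v≡1+w 1+w≡n))
  CycleSucc-functional (inj₂ (u≡0 , _)) (inj₂ (v≡0 , _)) = toℕ-injective (trans u≡0 (sym v≡0))

  Cycle-two-steps : ∀ {u w v} → u ≢ v → Cycle n u w → Cycle n w v →
    (CycleSucc n u w × CycleSucc n w v) ⊎ (CycleSucc n v w × CycleSucc n w u)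
  Cycle-two-steps u≢v (inj₁ u→w) (inj₁ w→v) = inj₁ (u→w , w→v)
  Cycle-two-steps u≢v (inj₂ w→u) (inj₂ v→w) = inj₂ (v→w , w→u)
  Cycle-two-steps u≢v (inj₁ u→w) (inj₂ v→w) = contradiction (CycleSucc-injective u→w v→w) u≢v
  Cycle-two-steps u≢v (inj₂ w→u) (inj₁ w→v) = contradiction (CycleSucc-functional w→u w→v) u≢v

  succ-colour : ∀ {A : Set} (c : ℕ → A) → c n ≡ c 0 →
    ∀ {u v} → CycleSucc n u v → c (toℕ v) ≡ c (suc (toℕ u))
  succ-colour c closes (inj₁ v≡1+u) = cong c v≡1+u
  succ-colour c closes {u} {v} (inj₂ (v≡0 , 1+u≡n)) = begin
    c (toℕ v)      ≡⟨ cong c v≡0 ⟩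
    c 0            ≡⟨ sym closes ⟩
    c n            ≡⟨ cong c (sym 1+u≡n) ⟩
    c (suc (toℕ u)) ∎
    where open ≡-Reasoning

Window : ∀ {k} → Subset k → Subset k → Subset k → Set
Window a b c = ∣ a ∣ ≡ 2 × ∣ a ∩ b ∣ ≡ 0 × ∣ a ∩ c ∣ ≡ 1

record GoodCyclicSequence (n : ℕ) {k : ℕ} (c : ℕ → Subset k) : Set where
  field
    closes₀ : c n ≡ c 0
    closes₁ : c (suc n) ≡ c 1
    window  : ∀ i → i < n → Window (c i) (c (suc i)) (c (suc (suc i)))

GoodCyclicSequence⇒isGood2ToneColoring : ∀ {n k} {c : ℕ → Subset k} → GoodCyclicSequence n c →
  IsGood2ToneColoring (Cycle n) k (λ v → c (toℕ v))
GoodCyclicSequence⇒isGood2ToneColoring {n} {k} {c} s = isGood2ToneColoring {f = f} sizes adjacent two-apart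
  where
  open GoodCyclicSequence s
  open ≡-Reasoning

  f : Fin n → Subset k
  f v = c (toℕ v)

  sizes : ∀ v → ∣ f v ∣ ≡ 2
  sizes v with window (toℕ v) (toℕ<n v)
  ... | size , _ , _ = size

  forward : ∀ {u v} → CycleSucc n u v → ∣ f u ∩ f v ∣ ≡ 0
  forward {u} {v} u→v with window (toℕ u) (toℕ<n u)
  ... | _ , disjoint , _ = begin
    ∣ f u ∩ f v ∣               ≡⟨ cong (λ x → ∣ f u ∩ x ∣) (succ-colour c closes₀ u→v) ⟩
    ∣ f u ∩ c (suc (toℕ u)) ∣   ≡⟨ disjoint ⟩
    0                           ∎

  forward² : ∀ {u w v} → CycleSucc n u w → CycleSucc n w v → ∣ f u ∩ f v ∣ ≡ 1
  forward² {u} {w} {v} u→w w→v with window (toℕ u) (toℕ<n u)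
  ... | _ , _ , meets = begin
    ∣ f u ∩ f v ∣                     ≡⟨ cong (λ x → ∣ f u ∩ x ∣) (succ-colour c closes₀ w→v) ⟩
    ∣ f u ∩ c (suc (toℕ w)) ∣         ≡⟨ cong (λ x → ∣ f u ∩ x ∣) (succ-colour (λ i → c (suc i)) closes₁ u→w) ⟩
    ∣ f u ∩ c (suc (suc (toℕ u))) ∣   ≡⟨ meets ⟩
    1                                 ∎

  swap : ∀ u v → ∣ f u ∩ f v ∣ ≡ ∣ f v ∩ f u ∣
  swap u v = cong ∣_∣ (∩-comm (f u) (f v))

  adjacent : ∀ {u v} → Cycle n u v → ∣ f u ∩ f v ∣ ≡ 0
  adjacent (inj₁ u→v) = forward u→v
  adjacent {u} {v} (inj₂ v→u) = trans (swap u v) (forward v→u)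

  two-apart : ∀ {u w v} → u ≢ v → Cycle n u w → Cycle n w v → ∣ f u ∩ f v ∣ ≡ 1
  two-apart {u} {v = v} u≢v e₁ e₂ with Cycle-two-steps u≢v e₁ e₂
  ... | inj₁ (u→w , w→v) = forward² u→w w→v
  ... | inj₂ (v→w , w→u) = trans (swap u v) (forward² v→w w→u)

⟪_,_⟫ : ∀ {k} → Fin k → Fin k → Subset k
⟪ i , j ⟫ = ⁅ i ⁆ ∪ ⁅ j ⁆

nth : ∀ {k} → List (Subset k) → ℕ → Subset k
nth []       _       = ⊥
nth (a ∷ as) zero    = a
nth (a ∷ as) (suc i) = nth as i

Windows : ∀ {k} → List (Subset k) → Set
Windows (a ∷ b ∷ c ∷ as) = Window a b c × Windows (b ∷ c ∷ as)
Windows _                = ⊤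

window? : ∀ {k} (a b c : Subset k) → Dec (Window a b c)
window? a b c = ∣ a ∣ ≟ 2 ×-dec ∣ a ∩ b ∣ ≟ 0 ×-dec ∣ a ∩ c ∣ ≟ 1

windows? : ∀ {k} (as : List (Subset k)) → Dec (Windows as)
windows? (a ∷ b ∷ c ∷ as) = window? a b c ×-dec windows? (b ∷ c ∷ as)
windows? []               = yes tt
windows? (a ∷ [])         = yes tt
windows? (a ∷ b ∷ [])     = yes tt

window-at : ∀ {k} (as : List (Subset k)) i → Windows as → suc (suc i) < length as →
  Window (nth as i) (nth as (suc i)) (nth as (suc (suc i)))
window-at (a ∷ b ∷ c ∷ as) zero    (w , _)  _        = w
window-at (a ∷ b ∷ c ∷ as) (suc i) (_ , ws) (s≤s lt) = window-at (b ∷ c ∷ as) i ws lt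
window-at (a ∷ b ∷ [])     i       _        (s≤s (s≤s ()))
window-at (a ∷ [])         i       _        (s≤s ())
window-at []               i       _        ()

colours-from₂ : ℕ → List (Subset 6)
colours-from₂ 0 = ⟪ 0F , 4F ⟫ ∷ ⟪ 2F , 5F ⟫ ∷ ⟪ 0F , 1F ⟫ ∷ ⟪ 2F , 3F ⟫ ∷ []
colours-from₂ 1 = ⟪ 0F , 4F ⟫ ∷ ⟪ 1F , 2F ⟫ ∷ ⟪ 3F , 4F ⟫ ∷ ⟪ 0F , 1F ⟫ ∷ ⟪ 2F , 3F ⟫ ∷ []
colours-from₂ 2 = ⟪ 0F , 4F ⟫ ∷ ⟪ 1F , 2F ⟫ ∷ ⟪ 0F , 3F ⟫ ∷ ⟪ 2F , 4F ⟫ ∷ ⟪ 0F , 1F ⟫ ∷ ⟪ 2F , 3F ⟫ ∷ []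
colours-from₂ 3 = ⟪ 0F , 4F ⟫ ∷ ⟪ 1F , 2F ⟫ ∷ ⟪ 0F , 3F ⟫ ∷ ⟪ 1F , 4F ⟫ ∷ ⟪ 3F , 5F ⟫ ∷ ⟪ 0F , 1F ⟫ ∷ ⟪ 2F , 3F ⟫ ∷ []
colours-from₂ (suc (suc (suc (suc m)))) =
  ⟪ 0F , 4F ⟫ ∷ ⟪ 2F , 5F ⟫ ∷ ⟪ 0F , 1F ⟫ ∷ ⟪ 2F , 3F ⟫ ∷ colours-from₂ m

-- The colours of vertices 0, 1, …, m + 3 of C_(m + 4), followed by those of
-- vertices 0 and 1 again. Splitting off the common first two entries makes
-- them definitionally ⟪ 0F , 1F ⟫ and ⟪ 2F , 3F ⟫ for every m.
colours : ℕ → List (Subset 6)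
colours m = ⟪ 0F , 1F ⟫ ∷ ⟪ 2F , 3F ⟫ ∷ colours-from₂ m

colours-length : ∀ m → length (colours m) ≡ 6 + m
colours-length 0 = refl
colours-length 1 = refl
colours-length 2 = refl
colours-length 3 = refl
colours-length (suc (suc (suc (suc m)))) = cong (4 +_) (colours-length m)

colours-closes : ∀ m → nth (colours m) (4 + m) ≡ ⟪ 0F , 1F ⟫ × nth (colours m) (5 + m) ≡ ⟪ 2F , 3F ⟫
colours-closes 0 = refl , refl
colours-closes 1 = refl , refl
colours-closes 2 = refl , refl
colours-closes 3 = refl , refl
colours-closes (suc (suc (suc (suc m)))) = colours-closes m

colours-windows : ∀ m → Windows (colours m)
colours-windows 0 = from-yes (windows? (colours 0))
colours-windows 1 = from-yes (windows? (colours 1))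
colours-windows 2 = from-yes (windows? (colours 2))
colours-windows 3 = from-yes (windows? (colours 3))
colours-windows (suc (suc (suc (suc m)))) =
  (refl , refl , refl) , (refl , refl , refl) , (refl , refl , refl) , (refl , refl , refl) ,
  colours-windows m

colours-good : ∀ m → GoodCyclicSequence (4 + m) (nth (colours m))
colours-good m = record
  { closes₀ = proj₁ (colours-closes m)
  ; closes₁ = proj₂ (colours-closes m)
  ; window  = λ i i<4+m → window-at (colours m) i (colours-windows m)
                (subst (suc (suc i) <_) (sym (colours-length m)) (s≤s (s≤s i<4+m)))
  }

triangle-colours : Fin 3 → Subset 6
triangle-colours 0F = ⟪ 0F , 1F ⟫
triangle-colours 1F = ⟪ 2F , 3F ⟫
triangle-colours 2F = ⟪ 4F , 5F ⟫

triangle-colours-sizes : ∀ v → ∣ triangle-colours v ∣ ≡ 2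
triangle-colours-sizes 0F = refl
triangle-colours-sizes 1F = refl
triangle-colours-sizes 2F = refl

triangle-colours-disjoint : ∀ {u v} → u ≢ v → ∣ triangle-colours u ∩ triangle-colours v ∣ ≡ 0
triangle-colours-disjoint {0F} {0F} u≢v = contradiction refl u≢v
triangle-colours-disjoint {0F} {1F} _   = refl
triangle-colours-disjoint {0F} {2F} _   = refl
triangle-colours-disjoint {1F} {0F} _   = refl
triangle-colours-disjoint {1F} {1F} u≢v = contradiction refl u≢v
triangle-colours-disjoint {1F} {2F} _   = refl
triangle-colours-disjoint {2F} {0F} _   = refl
triangle-colours-disjoint {2F} {1F} _   = refl
triangle-colours-disjoint {2F} {2F} u≢v = contradiction refl u≢v

Cycle₃-complete : ∀ {u v} → u ≢ v → Cycle 3 u v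
Cycle₃-complete {0F} {0F} u≢v = contradiction refl u≢v
Cycle₃-complete {0F} {1F} _   = inj₁ (inj₁ refl)
Cycle₃-complete {0F} {2F} _   = inj₂ (inj₂ (refl , refl))
Cycle₃-complete {1F} {0F} _   = inj₂ (inj₁ refl)
Cycle₃-complete {1F} {1F} u≢v = contradiction refl u≢v
Cycle₃-complete {1F} {2F} _   = inj₁ (inj₁ refl)
Cycle₃-complete {2F} {0F} _   = inj₁ (inj₂ (refl , refl))
Cycle₃-complete {2F} {1F} _   = inj₂ (inj₁ refl)
Cycle₃-complete {2F} {2F} u≢v = contradiction refl u≢v

mainTheorem3 : (n : ℕ) → 3 ≤ n → Σ (Fin n → Subset 6) (λ f → IsGood2ToneColoring (Cycle n) 6 f)
mainTheorem3 3 _ =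
  triangle-colours ,
  complete⇒isGood2ToneColoring {f = triangle-colours} Cycle₃-complete triangle-colours-sizes triangle-colours-disjoint
mainTheorem3 (suc (suc (suc (suc m)))) _ =
  (λ v → nth (colours m) (toℕ v)) , GoodCyclicSequence⇒isGood2ToneColoring (colours-good m)
mainTheorem3 0 ()
mainTheorem3 1 (s≤s ())
mainTheorem3 2 (s≤s (s≤s ()))
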